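{- Let $B$ be a Boolean algebra with an $M$-ideal $I$, and for each positive integer $n$ let $C_n=\{a\in B^+ : a\neq a_n \text{ for every } \{a_j\}_j\in I\}$. If $\{a_k\}_k$ is a sequence of elements of $B^+$ such that $a_k\notin C_k$ for every $k$, then $\{a_k\}_k\in I$.
   Context: A Boolean algebra here is an algebra $B$ of subsets of a nonempty set $S$ with operations $\cup,\cap$, complement, $\mathbf 0=\emptyset$, $\mathbf 1=S$, and $a\le b$ iff $a\subseteq b$; $B^+=B\setminus\{\mathbf 0\}$. An antichain is a set of pairwise disjoint elements of $B^+$. Sequences are indexed by positive integers. A set $I$ of infinite sequences in $B^+$ is an $M$-ideal if: (M1) if $\{a_n\}_n\in I$ then there is no $a>\mathbf 0$ with $a\le a_n$ for all $n$; (M2) if $s\in I$ and $t$ is an infinite subsequence of $s$ then $t\in I$; (M3) if $\{a_n\}_n\in I$ and $b_n\in B^+$ with $b_n\le a_n$ for all $n$ then $\{b_n\}_n\in I$; (M4) if $\{a_n\}_n,\{b_n\}_n\in I$ then $\{a_n\cup b_n\}_n$ has an infinite subsequence in $I$; (M5) if $\{a^k_n\}_n\in I$ for every $k$, then $\{a^n_n\}_n\in I$; (M6) if for every $n$, $A_n$ is a finite antichain with $|A_n|\ge n$, then there exist $a_n\in A_n$ with $\{a_n\}_n\in I$. -}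

module Defs where

open import Level using (Level; _⊔_) renaming (suc to lsuc)
open import Data.Nat using (ℕ; suc; _<_; _≤_)
open import Data.List using (List; length)
open import Data.List.Membership.Propositional using (_∈_)
open import Data.List.Relation.Unary.All using (All)
open import Data.List.Relation.Unary.AllPairs using (AllPairs)
open import Data.Product using (Σ; ∃; _×_)
open import Relation.Nullary using (¬_)
open import Algebra.Lattice.Bundles using (BooleanAlgebra)

-- Sequences are indexed by ℕ; index n stands for the (n+1)-st term
-- of the paper's sequence indexed by positive integers.

module _ {c ℓ : Level} (B : BooleanAlgebra c ℓ) where
  open BooleanAlgebra B renaming (¬_ to compl)

  Seq : Set c
  Seq = ℕ → Carrier

  _≤B_ : Carrier → Carrier → Set ℓ
  a ≤B b = (a ∧ b) ≈ a

  Pos : Carrier → Set ℓ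
  Pos a = ¬ (a ≈ ⊥)

  Antichain : List Carrier → Set (c ⊔ ℓ)
  Antichain A = All Pos A × AllPairs (λ x y → (x ∧ y) ≈ ⊥) A

  StrictlyIncreasing : (ℕ → ℕ) → Set
  StrictlyIncreasing φ = ∀ n → φ n < φ (suc n)

  record IsMIdeal {i : Level} (I : Seq → Set i) : Set (c ⊔ ℓ ⊔ i) where
    field
      inB⁺ : ∀ {s} → I s → ∀ n → Pos (s n)
      M1 : ∀ {s} → I s → ¬ (Σ Carrier λ a → Pos a × (∀ n → a ≤B s n))
      M2 : ∀ {s} → I s → (φ : ℕ → ℕ) → StrictlyIncreasing φ → I (λ n → s (φ n))
      M3 : ∀ {s} → I s → (t : Seq) → (∀ n → Pos (t n)) → (∀ n → t n ≤B s n) → I t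
      M4 : ∀ {s t} → I s → I t →
           Σ (ℕ → ℕ) λ φ → StrictlyIncreasing φ × I (λ n → s (φ n) ∨ t (φ n))
      M5 : (s : ℕ → Seq) → (∀ k → I (s k)) → I (λ n → s n n)
      -- index n ↦ the paper's n+1, so |A_n| ≥ n+1
      M6 : (A : ℕ → List Carrier) → (∀ n → Antichain (A n)) →
           (∀ n → suc n ≤ length (A n)) →
           Σ Seq λ a → (∀ n → a n ∈ A n) × I a

  C : {i : Level} → (Seq → Set i) → ℕ → Carrier → Set (c ⊔ ℓ ⊔ i)
  C I n a = Pos a × (∀ (s : Seq) → I s → ¬ (a ≈ s n))

module Submission where

-- A term a_k ∈ B⁺ that is not in C_k is, by definition
-- of C_k, not *not* the k-th term of some member of I; classically (the
-- theorem assumes excluded middle) we may therefore pick s^k ∈ I with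
-- a_k = s^k_k.  The diagonal {s^k_k}_k lies in I by (M5), and since a_k ≤ s^k_k
-- for every k, (M3) puts {a_k}_k in I.

open import Defs
open import Level using (Level; _⊔_)
open import Data.Nat using (ℕ)
open import Data.Product using (_×_; Σ; _,_; proj₁; proj₂)
open import Relation.Nullary using (¬_)
open import Axiom.ExcludedMiddle using (ExcludedMiddle)
open import Axiom.DoubleNegationElimination using (em⇒dne)
open import Algebra.Lattice.Bundles using (BooleanAlgebra)
import Algebra.Lattice.Properties.Lattice as LatticeProperties

module _ {c ℓ : Level} (B : BooleanAlgebra c ℓ) where
  open BooleanAlgebra B hiding (¬_)
  open LatticeProperties lattice using (∧-idem)

  ≈⇒≤B : ∀ {a b} → a ≈ b → _≤B_ B a b
  ≈⇒≤B {a} a≈b = trans (∧-congˡ (sym a≈b)) (∧-idem a)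

  IsTermOf : {i : Level} → (Seq B → Set i) → ℕ → Carrier → Set (c ⊔ ℓ ⊔ i)
  IsTermOf I k a = Σ (Seq B) λ s → I s × (a ≈ s k)

  dominated⇒∈I : {i : Level} {I : Seq B → Set i} → IsMIdeal B I →
                 (a : Seq B) → (∀ k → Pos B (a k)) →
                 (∀ k → Σ (Seq B) λ s → I s × _≤B_ B (a k) (s k)) →
                 I a
  dominated⇒∈I {I = I} MI a pos dom = M3 diagonal∈I a pos (λ k → proj₂ (proj₂ (dom k)))
    where
    open IsMIdeal MI
    diagonal∈I : I (λ k → proj₁ (dom k) k)
    diagonal∈I = M5 (λ k → proj₁ (dom k)) (λ k → proj₁ (proj₂ (dom k)))

  -- Classically, an element of B⁺ outside C_k is the k-th term of a member
  -- of I: the definition of C_k only says this is not impossible.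
  ¬C⇒IsTermOf : {i : Level} → ExcludedMiddle (c ⊔ ℓ ⊔ i) →
                (I : Seq B → Set i) → ∀ k a → Pos B a → ¬ C B I k a →
                IsTermOf I k a
  ¬C⇒IsTermOf em I k a pos a∉C =
    em⇒dne em λ notTerm → a∉C (pos , λ s s∈I a≈sk → notTerm (s , s∈I , a≈sk))

lemma3p4 : {c ℓ i : Level} → ExcludedMiddle (c ⊔ ℓ ⊔ i) →
           (B : BooleanAlgebra c ℓ) →
           ¬ (BooleanAlgebra._≈_ B (BooleanAlgebra.⊤ B) (BooleanAlgebra.⊥ B)) →
           (I : Seq B → Set i) → IsMIdeal B I →
           (a : Seq B) → (∀ k → Pos B (a k)) → (∀ k → ¬ C B I k (a k)) →
           I a
lemma3p4 em B _ I MI a pos a∉C = dominated⇒∈I B MI a pos dominating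
  where
  dominating : ∀ k → Σ (Seq B) λ s → I s × _≤B_ B (a k) (s k)
  dominating k with ¬C⇒IsTermOf B em I k (a k) (pos k) (a∉C k)
  ... | s , s∈I , ak≈sk = s , s∈I , ≈⇒≤B B ak≈sk
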